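{- An ordered group $(G,\le_G)$ is $\rhd_{\mathrm s}$-closed if and only if for all $a\in G$ and all integers $n>1$, $0\le_G na$ implies $0\le_G a$.
   Context: Groups are commutative; an ordered group has a partial order compatible with addition. $\mathrm{P}_{\mathrm{fe}}^*(G)$ is the set of nonempty finite subsets of $G$; $A-B=\{a-b\}$, $x+A=\{x+a\}$. $A\rhd_{\mathrm s}b$ iff $a\le_G b$ for some $a\in A$. A system of ideals for $G$ is a relation $\rhd$ between $\mathrm{P}_{\mathrm{fe}}^*(G)$ and $G$ with $a\rhd a$; $A\rhd b\Rightarrow A\cup A'\rhd b$; ($A\rhd c$ and $A\cup\{c\}\rhd b$) $\Rightarrow A\rhd b$; $a\le_G b\Rightarrow a\rhd b$; $A\rhd b\Rightarrow x+A\rhd x+b$. For $y_i\in G$, $\rhd_{y_1,\dots,y_n}$ is the finest system of ideals containing $\rhd$ with $0\rhd_{y_1,\dots,y_n}y_i$ for all $i$. Regularisation: $A\vdash_\rhd B$ iff there exist $x_1,\dots,x_m\in G$ with $A-B\rhd_{\pm x_1,\dots,\pm x_m}0$ for every choice of signs. $G$ is $\rhd$-closed if $a\vdash_\rhd b$ implies $a\le_G b$ for all $a,b\in G$. -}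

module Defs where

open import Level using (Level; _⊔_; suc)
open import Data.Nat using (ℕ)
open import Data.Bool using (Bool; true; false)
open import Data.Product using (Σ; ∃; _×_; _,_)
open import Data.List using (List; []; _∷_)
import Data.List as List
open import Data.List.NonEmpty using (List⁺; _∷_; [_]; toList)
import Data.List.NonEmpty as List⁺
open import Data.Vec using (Vec)
import Data.Vec as Vec
open import Algebra.Bundles using (AbelianGroup)
open import Relation.Binary.Structures using (IsPartialOrder)
import Data.List.Membership.Setoid as SetoidMembership
import Algebra.Definitions.RawMonoid as RawMonoidDefs

record OrderedGroup (c ℓ₁ ℓ₂ : Level) : Set (suc (c ⊔ ℓ₁ ⊔ ℓ₂)) where
  field
    abelianGroup : AbelianGroup c ℓ₁
  open AbelianGroup abelianGroup public
    renaming (_∙_ to _+_; ε to 0#; _⁻¹ to -_)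
  field
    _≤_            : Carrier → Carrier → Set ℓ₂
    isPartialOrder : IsPartialOrder _≈_ _≤_
    +-compatible   : ∀ {a b} x → a ≤ b → (x + a) ≤ (x + b)

  open RawMonoidDefs rawMonoid public using () renaming (_×_ to _·_)

module _ {c ℓ₁ ℓ₂ : Level} (G : OrderedGroup c ℓ₁ ℓ₂) where
  open OrderedGroup G
  open SetoidMembership setoid using (_∈_)

  -- Nonempty finite subsets of G, P*_fe(G), are represented by nonempty
  -- lists; only membership (up to ≈) matters, see `mono` below.
  Pfe : Set c
  Pfe = List⁺ Carrier

  _⊆_ : Pfe → Pfe → Set (c ⊔ ℓ₁)
  A ⊆ B = ∀ {x} → x ∈ toList A → x ∈ toList B

  _∪[_] : Pfe → Carrier → Pfe
  A ∪[ x ] = A List⁺.⁺∷ʳ x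

  _+ₛ_ : Carrier → Pfe → Pfe
  x +ₛ A = List⁺.map (x +_) A

  _-ₛ_ : Pfe → Pfe → Pfe
  A -ₛ B = List⁺.concatMap (λ a → List⁺.map (λ b → a - b) B) A

  Rel : (ℓ : Level) → Set (c ⊔ suc ℓ)
  Rel ℓ = Pfe → Carrier → Set ℓ

  ▷ₛ : Rel (c ⊔ ℓ₁ ⊔ ℓ₂)
  ▷ₛ A b = ∃ λ a → a ∈ toList A × a ≤ b

  -- The axiom "A ▷ b ⇒ A ∪ A' ▷ b" is
  -- stated as monotonicity along ⊆, which (since finite subsets are
  -- represented by lists) also expresses that ▷ only depends on the
  -- underlying set of A.
  record IsSystemOfIdeals {ℓ} (_▷_ : Rel ℓ) : Set (c ⊔ ℓ₁ ⊔ ℓ₂ ⊔ ℓ) where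
    field
      refl      : ∀ a → [ a ] ▷ a
      mono      : ∀ {A A' b} → A ⊆ A' → A ▷ b → A' ▷ b
      cut       : ∀ {A b x} → A ▷ x → (A ∪[ x ]) ▷ b → A ▷ b
      order     : ∀ {a b} → a ≤ b → [ a ] ▷ b
      translate : ∀ {A b} x → A ▷ b → (x +ₛ A) ▷ (x + b)

  -- ▷_{y₁,…,yₙ}: the finest system of ideals containing ▷ with 0 ▷ yᵢ
  -- for all i, given as the inductively generated closure.
  data Gen {ℓ} (_▷_ : Rel ℓ) (ys : List Carrier) : Rel (c ⊔ ℓ₁ ⊔ ℓ₂ ⊔ ℓ) where
    gen-base      : ∀ {A b} → A ▷ b → Gen _▷_ ys A b
    gen-zero       : ∀ {y} → y ∈ ys → Gen _▷_ ys [ 0# ] y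
    gen-refl      : ∀ a → Gen _▷_ ys [ a ] a
    gen-mono      : ∀ {A A' b} → A ⊆ A' → Gen _▷_ ys A b → Gen _▷_ ys A' b
    gen-cut       : ∀ {A b x} → Gen _▷_ ys A x → Gen _▷_ ys (A ∪[ x ]) b →
                Gen _▷_ ys A b
    gen-order     : ∀ {a b} → a ≤ b → Gen _▷_ ys [ a ] b
    gen-translate : ∀ {A b} x → Gen _▷_ ys A b → Gen _▷_ ys (x +ₛ A) (x + b)

  signed : ∀ {m} → Vec Bool m → Vec Carrier m → List Carrier
  signed ss xs = Vec.toList (Vec.zipWith (λ { true x → x ; false x → - x }) ss xs)

  Regularisation : ∀ {ℓ} → Rel ℓ → Pfe → Pfe → Set (c ⊔ ℓ₁ ⊔ ℓ₂ ⊔ ℓ)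
  Regularisation _▷_ A B =
    Σ ℕ λ m → Σ (Vec Carrier m) λ xs →
      ∀ (ss : Vec Bool m) → Gen _▷_ (signed ss xs) (A -ₛ B) 0#

  IsClosed : ∀ {ℓ} → Rel ℓ → Set (c ⊔ ℓ₁ ⊔ ℓ₂ ⊔ ℓ)
  IsClosed _▷_ = ∀ a b → Regularisation _▷_ [ a ] [ b ] → a ≤ b

-- Everything derivable in ▷ₛ_{y₁,…,yₙ} is of the form A ▷ b with a + t ≤ b
-- for some a ∈ A and some ℕ-linear combination t of the yᵢ.  So if a ⊢ b is
-- witnessed by x₁,…,xₘ, then for every choice of signs some element of the
-- cone of ±x₁,…,±xₘ lies below a positive multiple of b - a.  Eliminating the
-- xᵢ one at a time, Fourier–Motzkin style (add positive multiples of the two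
-- sign choices so that xᵢ cancels), leaves 0 ≤ n(b - a) with n ≥ 1, and the
-- hypothesis on multiples gives a ≤ b.  Conversely, if 0 ≤ na then
-- -a ▷ₛ_{±a} 0 under both signs (for the sign -a because -a ▷ n(-a) ≤ 0),
-- so 0 ⊢ a and closedness yields 0 ≤ a.
module Submission where

open import Defs
open import Level using (Level; _⊔_; Lift; lift)
open import Data.Nat using (ℕ; zero; suc; s≤s; z≤n) renaming (_≤_ to _≤ℕ_)
import Data.Nat as ℕ
import Data.Nat.Properties as ℕ
open import Data.Bool using (true; false)
open import Data.Product using (∃; ∃₂; _×_; _,_)
open import Data.Sum using (inj₁; inj₂)
open import Data.List using (List; []; _∷_)
open import Data.List.NonEmpty using (_∷_; [_]; toList)
open import Data.List.Relation.Unary.Any using (here; there)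
open import Data.Vec using (Vec; []; _∷_)
open import Function.Bundles using (_⇔_; mk⇔)
open import Relation.Binary.Structures using (IsPartialOrder)
import Algebra.Properties.AbelianGroup as AbelianGroupProperties
import Algebra.Properties.CommutativeMonoid.Mult as MultProperties
import Algebra.Properties.CommutativeSemigroup as CommutativeSemigroupProperties
import Data.List.Membership.Setoid as SetoidMembership
open import Data.List.Membership.Setoid.Properties using (∈-++⁻; ∈-++⁺ʳ; ∈-map⁺)
import Relation.Binary.Reasoning.Setoid as SetoidReasoning

module _ {c ℓ₁ ℓ₂ : Level} (G : OrderedGroup c ℓ₁ ℓ₂) where
  open OrderedGroup G renaming (_≤_ to infix 4 _≤_)
  open IsPartialOrder isPartialOrder using ()
    renaming (reflexive to ≤-reflexive; trans to ≤-trans; ≲-respˡ-≈ to ≤-respˡ-≈; ≲-respʳ-≈ to ≤-respʳ-≈)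
  open AbelianGroupProperties abelianGroup using (⁻¹-anti-homo‿-; xyx⁻¹≈y)
  open MultProperties commutativeMonoid using (×-distrib-+; ×-homo-+; ×-assocˡ; ×-congʳ; ×-congˡ)
  open CommutativeSemigroupProperties commutativeSemigroup using (interchange)
  open SetoidMembership setoid using (_∈_)
  open SetoidReasoning setoid

  Unperforated : Set (c ⊔ ℓ₂)
  Unperforated = ∀ a n → 2 ≤ℕ n → 0# ≤ n · a → 0# ≤ a

  +-monoˡ-≤ : ∀ {a b} x → a ≤ b → a + x ≤ b + x
  +-monoˡ-≤ {a} {b} x a≤b = ≤-respˡ-≈ (comm x a) (≤-respʳ-≈ (comm x b) (+-compatible x a≤b))

  +-mono-≤ : ∀ {a b u v} → a ≤ b → u ≤ v → a + u ≤ b + v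
  +-mono-≤ {b = b} {u} a≤b u≤v = ≤-trans (+-monoˡ-≤ u a≤b) (+-compatible b u≤v)

  ·-monoʳ-≤ : ∀ {a b} n → a ≤ b → n · a ≤ n · b
  ·-monoʳ-≤ zero    a≤b = ≤-reflexive refl
  ·-monoʳ-≤ (suc n) a≤b = +-mono-≤ a≤b (·-monoʳ-≤ n a≤b)

  +≤0⇒≤- : ∀ {x t} → x + t ≤ 0# → t ≤ (- x)
  +≤0⇒≤- {x} {t} x+t≤0 = ≤-respˡ-≈ -x+[x+t]≈t (≤-respʳ-≈ (identityʳ (- x)) (+-compatible (- x) x+t≤0))
    where
      -x+[x+t]≈t : - x + (x + t) ≈ t
      -x+[x+t]≈t = begin
        - x + (x + t) ≈⟨ assoc (- x) x t ⟨
        (- x + x) + t ≈⟨ ∙-congʳ (inverseˡ x) ⟩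
        0# + t        ≈⟨ identityˡ t ⟩
        t             ∎

  0≤-⇒≤ : ∀ {a b} → 0# ≤ (b - a) → a ≤ b
  0≤-⇒≤ {a} {b} 0≤b-a =
    ≤-respˡ-≈ (identityʳ a) (≤-respʳ-≈ (trans (sym (assoc a b (- a))) (xyx⁻¹≈y a b)) (+-compatible a 0≤b-a))

  ·-zeroʳ : ∀ n → n · 0# ≈ 0#
  ·-zeroʳ zero    = refl
  ·-zeroʳ (suc n) = trans (identityˡ (n · 0#)) (·-zeroʳ n)

  ·-inverseʳ : ∀ n x → n · x + n · (- x) ≈ 0#
  ·-inverseʳ n x = begin
    n · x + n · (- x) ≈⟨ ×-distrib-+ x (- x) n ⟨
    n · (x - x)       ≈⟨ ×-congʳ n (inverseʳ x) ⟩
    n · 0#            ≈⟨ ·-zeroʳ n ⟩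
    0#                ∎

  0≤·⇒·-≤0 : ∀ n {a} → 0# ≤ n · a → n · (- a) ≤ 0#
  0≤·⇒·-≤0 n {a} 0≤na = ≤-respˡ-≈ (identityʳ (n · (- a)))
    (≤-respʳ-≈ (trans (comm (n · (- a)) (n · a)) (·-inverseʳ n a)) (+-compatible (n · (- a)) 0≤na))

  ·-cross-cancel : ∀ k l x → l · (k · x) + k · (l · (- x)) ≈ 0#
  ·-cross-cancel k l x = begin
    l · (k · x) + k · (l · (- x))      ≈⟨ ∙-cong (×-assocˡ x l k) (×-assocˡ (- x) k l) ⟩
    (l ℕ.* k) · x + (k ℕ.* l) · (- x)  ≈⟨ ∙-congʳ (×-congˡ (ℕ.*-comm l k)) ⟩
    (k ℕ.* l) · x + (k ℕ.* l) · (- x)  ≈⟨ ·-inverseʳ (k ℕ.* l) x ⟩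
    0#                                 ∎

  ·-combine : ∀ k m l n d → k · (m · d) + l · (n · d) ≈ (k ℕ.* m ℕ.+ l ℕ.* n) · d
  ·-combine k m l n d =
    trans (∙-cong (×-assocˡ d k m) (×-assocˡ d l n)) (sym (×-homo-+ d (k ℕ.* m) (l ℕ.* n)))

  Cone : List Carrier → Carrier → Set (c ⊔ ℓ₁)
  Cone []       t = Lift c (t ≈ 0#)
  Cone (y ∷ ys) t = ∃₂ λ k t′ → Cone ys t′ × t ≈ k · y + t′

  Cone-0# : ∀ ys → Cone ys 0#
  Cone-0# []       = lift refl
  Cone-0# (y ∷ ys) = 0 , 0# , Cone-0# ys , sym (identityˡ 0#)

  Cone-+ : ∀ ys {t u} → Cone ys t → Cone ys u → Cone ys (t + u)
  Cone-+ []       (lift t≈0) (lift u≈0) = lift (trans (∙-cong t≈0 u≈0) (identityˡ 0#))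
  Cone-+ (y ∷ ys) {t} {u} (k , t′ , t′∈ , t≈) (l , u′ , u′∈ , u≈) =
    k ℕ.+ l , t′ + u′ , Cone-+ ys t′∈ u′∈ , (begin
      t + u                           ≈⟨ ∙-cong t≈ u≈ ⟩
      (k · y + t′) + (l · y + u′)     ≈⟨ interchange (k · y) t′ (l · y) u′ ⟩
      (k · y + l · y) + (t′ + u′)     ≈⟨ ∙-congʳ (×-homo-+ y k l) ⟨
      (k ℕ.+ l) · y + (t′ + u′)       ∎)

  Cone-· : ∀ ys {t} n → Cone ys t → Cone ys (n · t)
  Cone-· ys zero    t∈ = Cone-0# ys
  Cone-· ys (suc n) t∈ = Cone-+ ys t∈ (Cone-· ys n t∈)

  ∈⇒Cone : ∀ {y} ys → y ∈ ys → Cone ys y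
  ∈⇒Cone {y} (z ∷ ys) (here y≈z) =
    1 , 0# , Cone-0# ys , trans y≈z (sym (trans (identityʳ (1 · z)) (identityʳ z)))
  ∈⇒Cone {y} (z ∷ ys) (there y∈) = 0 , y , ∈⇒Cone ys y∈ , sym (identityˡ y)

  _▷ₛ[_]_ : Pfe G → List Carrier → Carrier → Set (c ⊔ ℓ₁ ⊔ ℓ₂)
  A ▷ₛ[ ys ] b = ∃₂ λ a t → a ∈ toList A × Cone ys t × a + t ≤ b

  Gen⇒▷ₛ[] : ∀ {ys A b} → Gen G (▷ₛ G) ys A b → A ▷ₛ[ ys ] b
  Gen⇒▷ₛ[] {ys} (gen-base (a , a∈ , a≤b)) =
    a , 0# , a∈ , Cone-0# ys , ≤-respˡ-≈ (sym (identityʳ a)) a≤b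
  Gen⇒▷ₛ[] {ys} (gen-zero {y} y∈) =
    0# , y , here refl , ∈⇒Cone ys y∈ , ≤-reflexive (identityˡ y)
  Gen⇒▷ₛ[] {ys} (gen-refl a) =
    a , 0# , here refl , Cone-0# ys , ≤-reflexive (identityʳ a)
  Gen⇒▷ₛ[] (gen-mono A⊆A′ p) with Gen⇒▷ₛ[] p
  ... | a , t , a∈ , t∈ , a+t≤b = a , t , A⊆A′ a∈ , t∈ , a+t≤b
  Gen⇒▷ₛ[] {ys} (gen-cut {A = A@(h ∷ hs)} {x = x} p q) with Gen⇒▷ₛ[] p | Gen⇒▷ₛ[] q
  ... | a , t , a∈A , t∈ , a+t≤x | a′ , t′ , a′∈A∪x , t′∈ , a′+t′≤b with ∈-++⁻ setoid (toList A) a′∈A∪x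
  ...   | inj₁ a′∈A        = a′ , t′ , a′∈A , t′∈ , a′+t′≤b
  ...   | inj₂ (here a′≈x) = a , t + t′ , a∈A , Cone-+ ys t∈ t′∈ ,
    ≤-trans (≤-respˡ-≈ (assoc a t t′) (+-monoˡ-≤ t′ a+t≤x)) (≤-respˡ-≈ (∙-congʳ a′≈x) a′+t′≤b)
  Gen⇒▷ₛ[] {ys} (gen-order {a} a≤b) =
    a , 0# , here refl , Cone-0# ys , ≤-respˡ-≈ (sym (identityʳ a)) a≤b
  Gen⇒▷ₛ[] (gen-translate {A = h ∷ hs} x p) with Gen⇒▷ₛ[] p
  ... | a , t , a∈ , t∈ , a+t≤b =
    x + a , t , ∈-map⁺ setoid setoid ∙-congˡ a∈ , t∈ , ≤-respˡ-≈ (sym (assoc x a t)) (+-compatible x a+t≤b)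

  -- The multiple is written suc M so that it is positive by construction.
  ConeBelowMultiple : List Carrier → Carrier → Set (c ⊔ ℓ₁ ⊔ ℓ₂)
  ConeBelowMultiple ys d = ∃₂ λ M t → Cone ys t × t ≤ suc M · d

  ConeBelowMultiple-eliminate : ∀ {x ys d} →
    ConeBelowMultiple (x ∷ ys) d → ConeBelowMultiple (- x ∷ ys) d → ConeBelowMultiple ys d
  ConeBelowMultiple-eliminate (M , t , (zero , t′ , t′∈ , t≈) , t≤) _ =
    M , t′ , t′∈ , ≤-respˡ-≈ (trans t≈ (identityˡ t′)) t≤
  ConeBelowMultiple-eliminate _ (M , u , (zero , u′ , u′∈ , u≈) , u≤) =
    M , u′ , u′∈ , ≤-respˡ-≈ (trans u≈ (identityˡ u′)) u≤
  ConeBelowMultiple-eliminate {x} {ys} {d}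
    (M , t , (suc i , t′ , t′∈ , t≈) , t≤) (N , u , (suc j , u′ , u′∈ , u≈) , u≤) =
    -- the successor of this witness reduces to l * suc M + k * suc N
    M ℕ.+ j ℕ.* suc M ℕ.+ k ℕ.* suc N , l · t′ + k · u′ ,
    Cone-+ ys (Cone-· ys l t′∈) (Cone-· ys k u′∈) ,
    ≤-respˡ-≈ x-cancels (≤-respʳ-≈ (·-combine l (suc M) k (suc N) d) (+-mono-≤ (·-monoʳ-≤ l t≤) (·-monoʳ-≤ k u≤)))
    where
      k = suc i
      l = suc j
      x-cancels : l · t + k · u ≈ l · t′ + k · u′
      x-cancels = begin
        l · t + k · u                                        ≈⟨ ∙-cong (×-congʳ l t≈) (×-congʳ k u≈) ⟩
        l · (k · x + t′) + k · (l · (- x) + u′)              ≈⟨ ∙-cong (×-distrib-+ (k · x) t′ l) (×-distrib-+ (l · (- x)) u′ k) ⟩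
        (l · (k · x) + l · t′) + (k · (l · (- x)) + k · u′)  ≈⟨ interchange (l · (k · x)) (l · t′) (k · (l · (- x))) (k · u′) ⟩
        (l · (k · x) + k · (l · (- x))) + (l · t′ + k · u′)  ≈⟨ ∙-congʳ (·-cross-cancel k l x) ⟩
        0# + (l · t′ + k · u′)                               ≈⟨ identityˡ (l · t′ + k · u′) ⟩
        l · t′ + k · u′                                      ∎

  ConeBelowMultiple-allSigns : ∀ {m d} (xs : Vec Carrier m) →
    (∀ ss → ConeBelowMultiple (signed G ss xs) d) → ∃ λ M → 0# ≤ suc M · d
  ConeBelowMultiple-allSigns [] below with below []
  ... | M , t , lift t≈0 , t≤ = M , ≤-respˡ-≈ t≈0 t≤
  ConeBelowMultiple-allSigns (x ∷ xs) below = ConeBelowMultiple-allSigns xs λ ss →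
    ConeBelowMultiple-eliminate (below (true ∷ ss)) (below (false ∷ ss))

  Unperforated⇒0≤·⇒0≤ : Unperforated → ∀ {d} → ∃ (λ M → 0# ≤ suc M · d) → 0# ≤ d
  Unperforated⇒0≤·⇒0≤ unperforated {d} (zero  , 0≤d+0) = ≤-respʳ-≈ (identityʳ d) 0≤d+0
  Unperforated⇒0≤·⇒0≤ unperforated {d} (suc M , 0≤nd)  = unperforated d (suc (suc M)) (s≤s (s≤s z≤n)) 0≤nd

  Unperforated⇒closed : Unperforated → IsClosed G (▷ₛ G)
  Unperforated⇒closed unperforated a b (m , xs , a-b▷0) =
    0≤-⇒≤ (Unperforated⇒0≤·⇒0≤ unperforated (ConeBelowMultiple-allSigns xs below))
    where
      below : ∀ ss → ConeBelowMultiple (signed G ss xs) (b - a)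
      below ss with Gen⇒▷ₛ[] (a-b▷0 ss)
      ... | a′ , t , here a′≈a-b , t∈ , a′+t≤0 =
        0 , t , t∈ , ≤-respʳ-≈ (trans (⁻¹-anti-homo‿- a b) (sym (identityʳ (b - a))))
                       (+≤0⇒≤- (≤-respˡ-≈ (∙-congʳ a′≈a-b) a′+t≤0))

  gen-resp-≈ : ∀ {ys u v b} → u ≈ v → Gen G (▷ₛ G) ys [ u ] b → Gen G (▷ₛ G) ys [ v ] b
  gen-resp-≈ u≈v = gen-mono λ { (here w≈u) → here (trans w≈u u≈v) }

  gen-≤ : ∀ {ys A x b} → Gen G (▷ₛ G) ys A x → x ≤ b → Gen G (▷ₛ G) ys A b
  gen-≤ {A = A@(h ∷ hs)} A▷x x≤b =
    gen-cut A▷x (gen-mono (λ { (here w≈x) → ∈-++⁺ʳ setoid (toList A) (here w≈x) ; (there ()) }) (gen-order x≤b))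

  gen-· : ∀ {ys y} → y ∈ ys → ∀ k → Gen G (▷ₛ G) ys [ 0# ] (k · y)
  gen-· y∈ zero    = gen-refl 0#
  gen-· {y = y} y∈ (suc k) =
    gen-cut (gen-zero y∈)
      (gen-mono (λ { (here w≈y+0) → there (here (trans w≈y+0 (identityʳ y))) ; (there ()) })
        (gen-translate y (gen-· y∈ k)))

  closed⇒Unperforated : IsClosed G (▷ₛ G) → Unperforated
  closed⇒Unperforated closed a (suc k) _ 0≤na = closed 0# a (1 , a ∷ [] , 0-a▷0)
    where
      shift : ∀ {ys y} → Gen G (▷ₛ G) ys [ 0# ] y → - a + y ≤ 0# → Gen G (▷ₛ G) ys [ 0# - a ] 0#
      shift 0▷y -a+y≤0 = gen-resp-≈ (comm (- a) 0#) (gen-≤ (gen-translate (- a) 0▷y) -a+y≤0)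

      0-a▷0 : ∀ ss → Gen G (▷ₛ G) (signed G ss (a ∷ [])) [ 0# - a ] 0#
      0-a▷0 (true ∷ [])  = shift (gen-zero (here refl)) (≤-reflexive (inverseˡ a))
      0-a▷0 (false ∷ []) = shift (gen-· (here refl) k) (0≤·⇒·-≤0 (suc k) 0≤na)

corollary4p13 : ∀ {c ℓ₁ ℓ₂ : Level} (G : OrderedGroup c ℓ₁ ℓ₂) →
    IsClosed G (▷ₛ G) ⇔
    (∀ (a : OrderedGroup.Carrier G) (n : ℕ) → 2 ≤ℕ n →
    OrderedGroup._≤_ G (OrderedGroup.0# G) (OrderedGroup._·_ G n a) →
    OrderedGroup._≤_ G (OrderedGroup.0# G) a)
corollary4p13 G = mk⇔ (closed⇒Unperforated G) (Unperforated⇒closed G)
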